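{- Let $w$ be a word over $\{0,1\}$ of length at least $2$, let $a\in\{0,1\}$, and let $k$ be a power of $2$ such that $a^k$ is not a factor (contiguous subword) of $w$. Then every cycle of the permutation $S_a(w)$ has length at most $k$.
   Context: For words $w=w_1\cdots w_\ell$, $u=u_1\cdots u_\ell$ over $\{0,1\}$ and $a\in\{0,1\}$, $S_a(w)(u)\in\{0,1\}^\ell$ is the word with $\ell$-th letter $u_\ell$ and $i$-th letter $u_i\oplus(u_{i+1}\wedge[w_{i+1}=a])$ for $1\le i\le\ell-1$ ($[\cdot]$ the indicator; $\oplus,\wedge$ XOR/AND); $S_a(w)$ is a bijection of $\{0,1\}^\ell$, and its cycles are the orbits $\{S_a(w)^n(u):n\ge0\}$. $a^k$ is the word of $k$ copies of $a$. -}

module Defs where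

open import Data.Bool using (Bool; true; false; _xor_; _∧_; if_then_else_)
open import Data.Bool.Properties using () renaming (_≟_ to _≟B_)
open import Data.Nat using (ℕ; zero; suc)
open import Data.Vec using (Vec; []; _∷_; toList)
open import Data.List using (List; _++_; replicate)
open import Data.Product using (∃; ∃-syntax; _×_)
open import Relation.Binary.PropositionalEquality using (_≡_)
open import Relation.Nullary.Decidable using (⌊_⌋)

[_≡ᵇ_] : Bool → Bool → Bool
[ x ≡ᵇ a ] = ⌊ x ≟B a ⌋

S : {ℓ : ℕ} → Bool → Vec Bool ℓ → Vec Bool ℓ → Vec Bool ℓ
S a [] [] = []
S a (w₁ ∷ []) (u₁ ∷ []) = u₁ ∷ []
S a (w₁ ∷ w₂ ∷ ws) (u₁ ∷ u₂ ∷ us) =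
  (u₁ xor (u₂ ∧ [ w₂ ≡ᵇ a ])) ∷ S a (w₂ ∷ ws) (u₂ ∷ us)

iter : {A : Set} → (A → A) → ℕ → A → A
iter f zero x = x
iter f (suc n) x = f (iter f n x)

IsFactor : List Bool → List Bool → Set
IsFactor v w = ∃[ p ] ∃[ s ] (w ≡ p ++ v ++ s)

pow : Bool → ℕ → List Bool
pow a k = replicate k a

-- Over GF(2), S_a(w) = I + N where N u has i-th letter u_{i+1} ∧ [w_{i+1} = a] and
-- last letter 0. N is linear and commutes with I, so in characteristic 2 the
-- Frobenius identity gives S^(2^m) = I + N^(2^m). A letter of N^j u can be 1 only
-- at a position i with w_{i+1} ⋯ w_{i+j} = a^j; if a^k is not a factor of w then
-- N^k = 0, hence S^k = I and every cycle length divides k.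
module Submission where

open import Defs
open import Data.Bool using (Bool; true; false; T; _xor_; _∧_)
open import Data.Bool.Properties
  using (xor-assoc; xor-identityˡ; xor-identityʳ; xor-same; ∧-distribʳ-xor; T-∧)
  renaming (_≟_ to _≟B_)
open import Data.Empty using (⊥-elim)
open import Data.List using (List; _++_)
import Data.List as List
open import Data.Nat using (ℕ; zero; suc; _+_; _≤_; _^_)
open import Data.Nat.Properties using (+-identityʳ; ≤-refl; m^n>0)
open import Data.Product using (∃-syntax; _×_; _,_)
open import Data.Unit using (⊤; tt)
open import Data.Vec using (Vec; []; _∷_; toList; replicate; zipWith)
open import Data.Vec.Relation.Binary.Pointwise.Inductive
  using (Pointwise-≡⇒≡; zipWith-assoc; zipWith-identityˡ; zipWith-identityʳ)
open import Function using (_∘_; Equivalence)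
open import Relation.Binary.PropositionalEquality
  using (_≡_; refl; sym; trans; cong; cong₂; module ≡-Reasoning)
open import Relation.Nullary using (¬_)
open import Relation.Nullary.Decidable using (toWitness)

private
  variable
    n : ℕ

infixl 6 _⊕_

_⊕_ : Vec Bool n → Vec Bool n → Vec Bool n
_⊕_ = zipWith _xor_

𝟘 : Vec Bool n
𝟘 = replicate _ false

⊕-assoc : (x y z : Vec Bool n) → (x ⊕ y) ⊕ z ≡ x ⊕ (y ⊕ z)
⊕-assoc x y z = Pointwise-≡⇒≡ (zipWith-assoc xor-assoc x y z)

⊕-identityˡ : (x : Vec Bool n) → 𝟘 ⊕ x ≡ x
⊕-identityˡ x = Pointwise-≡⇒≡ (zipWith-identityˡ xor-identityˡ x)

⊕-identityʳ : (x : Vec Bool n) → x ⊕ 𝟘 ≡ x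
⊕-identityʳ x = Pointwise-≡⇒≡ (zipWith-identityʳ xor-identityʳ x)

⊕-self : (x : Vec Bool n) → x ⊕ x ≡ 𝟘
⊕-self []       = refl
⊕-self (x ∷ xs) = cong₂ _∷_ (xor-same x) (⊕-self xs)

⊕-cancel-middle : (x y z : Vec Bool n) → (x ⊕ y) ⊕ (y ⊕ z) ≡ x ⊕ z
⊕-cancel-middle x y z = begin
  (x ⊕ y) ⊕ (y ⊕ z)  ≡⟨ ⊕-assoc x y (y ⊕ z) ⟩
  x ⊕ (y ⊕ (y ⊕ z))  ≡⟨ cong (x ⊕_) (sym (⊕-assoc y y z)) ⟩
  x ⊕ ((y ⊕ y) ⊕ z)  ≡⟨ cong (λ t → x ⊕ (t ⊕ z)) (⊕-self y) ⟩
  x ⊕ (𝟘 ⊕ z)        ≡⟨ cong (x ⊕_) (⊕-identityˡ z) ⟩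
  x ⊕ z              ∎
  where open ≡-Reasoning

Additive : (Vec Bool n → Vec Bool n) → Set
Additive f = ∀ x y → f (x ⊕ y) ≡ f x ⊕ f y

iter-+ : {A : Set} (f : A → A) (p q : ℕ) (x : A) → iter f (p + q) x ≡ iter f p (iter f q x)
iter-+ f zero    q x = refl
iter-+ f (suc p) q x = cong f (iter-+ f p q x)

iter-2^suc : {A : Set} (f : A → A) (m : ℕ) (x : A) →
  iter f (2 ^ suc m) x ≡ iter f (2 ^ m) (iter f (2 ^ m) x)
iter-2^suc f m x = trans (cong (λ t → iter f (2 ^ m + t) x) (+-identityʳ (2 ^ m)))
                         (iter-+ f (2 ^ m) (2 ^ m) x)

iter-additive : {f : Vec Bool n → Vec Bool n} → Additive f → ∀ k → Additive (iter f k)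
iter-additive         f-add zero    x y = refl
iter-additive {f = f} f-add (suc k) x y =
  trans (cong f (iter-additive f-add k x y)) (f-add _ _)

iter-id⊕-2^ : {f g : Vec Bool n → Vec Bool n} → Additive f → (∀ x → g x ≡ x ⊕ f x) →
  ∀ m x → iter g (2 ^ m) x ≡ x ⊕ iter f (2 ^ m) x
iter-id⊕-2^         f-add g≡id⊕f zero    x = g≡id⊕f x
iter-id⊕-2^ {f = f} {g} f-add g≡id⊕f (suc m) x = begin
  iter g (2 ^ suc m) x         ≡⟨ iter-2^suc g m x ⟩
  G (G x)                      ≡⟨ iter-id⊕-2^ f-add g≡id⊕f m (G x) ⟩
  G x ⊕ F (G x)                ≡⟨ cong (λ y → y ⊕ F y) (iter-id⊕-2^ f-add g≡id⊕f m x) ⟩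
  (x ⊕ F x) ⊕ F (x ⊕ F x)      ≡⟨ cong ((x ⊕ F x) ⊕_) (iter-additive f-add (2 ^ m) x (F x)) ⟩
  (x ⊕ F x) ⊕ (F x ⊕ F (F x))  ≡⟨ ⊕-cancel-middle x (F x) (F (F x)) ⟩
  x ⊕ F (F x)                  ≡⟨ cong (x ⊕_) (sym (iter-2^suc f m x)) ⟩
  x ⊕ iter f (2 ^ suc m) x     ∎
  where
  open ≡-Reasoning
  G = iter g (2 ^ m)
  F = iter f (2 ^ m)

N : Bool → Vec Bool n → Vec Bool n → Vec Bool n
N a []             []             = []
N a (w₁ ∷ [])      (u₁ ∷ [])      = false ∷ []
N a (w₁ ∷ w₂ ∷ ws) (u₁ ∷ u₂ ∷ us) = (u₂ ∧ [ w₂ ≡ᵇ a ]) ∷ N a (w₂ ∷ ws) (u₂ ∷ us)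

S≡id⊕N : (a : Bool) (w u : Vec Bool n) → S a w u ≡ u ⊕ N a w u
S≡id⊕N a []             []             = refl
S≡id⊕N a (w₁ ∷ [])      (u₁ ∷ [])      = cong (_∷ []) (sym (xor-identityʳ u₁))
S≡id⊕N a (w₁ ∷ w₂ ∷ ws) (u₁ ∷ u₂ ∷ us) = cong (_ ∷_) (S≡id⊕N a (w₂ ∷ ws) (u₂ ∷ us))

N-additive : (a : Bool) (w : Vec Bool n) → Additive (N a w)
N-additive a []             []             []             = refl
N-additive a (w₁ ∷ [])      (x₁ ∷ [])      (y₁ ∷ [])      = refl
N-additive a (w₁ ∷ w₂ ∷ ws) (x₁ ∷ x₂ ∷ xs) (y₁ ∷ y₂ ∷ ys) =
  cong₂ _∷_ (∧-distribʳ-xor _ x₂ y₂) (N-additive a (w₂ ∷ ws) (x₂ ∷ xs) (y₂ ∷ ys))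

StartsWithRun : Bool → ℕ → List Bool → Set
StartsWithRun a j l = ∃[ s ] (l ≡ pow a j ++ s)

IsFactor-∷ : ∀ {v l} x → IsFactor v l → IsFactor v (x List.∷ l)
IsFactor-∷ x (p , s , eq) = x List.∷ p , s , cong (x List.∷_) eq

OnlyBeforeRuns : Bool → ℕ → Vec Bool n → Vec Bool n → Set
OnlyBeforeRuns a j []        []        = ⊤
OnlyBeforeRuns a j (w₁ ∷ ws) (v₁ ∷ vs) =
  (T v₁ → StartsWithRun a j (toList ws)) × OnlyBeforeRuns a j ws vs

onlyBeforeRuns-zero : (a : Bool) (w v : Vec Bool n) → OnlyBeforeRuns a 0 w v
onlyBeforeRuns-zero a []        []        = tt
onlyBeforeRuns-zero a (w₁ ∷ ws) (v₁ ∷ vs) = (λ _ → toList ws , refl) , onlyBeforeRuns-zero a ws vs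

onlyBeforeRuns-N : (a : Bool) (j : ℕ) (w v : Vec Bool n) →
  OnlyBeforeRuns a j w v → OnlyBeforeRuns a (suc j) w (N a w v)
onlyBeforeRuns-N a j []             []             _ = tt
onlyBeforeRuns-N a j (w₁ ∷ [])      (v₁ ∷ [])      _ = (λ ()) , tt
onlyBeforeRuns-N a j (w₁ ∷ w₂ ∷ ws) (v₁ ∷ v₂ ∷ vs) (_ , run₂ , rest) =
  extend , onlyBeforeRuns-N a j (w₂ ∷ ws) (v₂ ∷ vs) (run₂ , rest)
  where
  extend : T (v₂ ∧ [ w₂ ≡ᵇ a ]) → StartsWithRun a (suc j) (w₂ List.∷ toList ws)
  extend marked with Equivalence.to T-∧ marked
  ... | v₂-set , w₂≡a? with run₂ v₂-set | toWitness {a? = w₂ ≟B a} w₂≡a?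
  ...   | s , eq | refl = s , cong (w₂ List.∷_) eq

onlyBeforeRuns-iterN : (a : Bool) (j : ℕ) (w u : Vec Bool n) →
  OnlyBeforeRuns a j w (iter (N a w) j u)
onlyBeforeRuns-iterN a zero    w u = onlyBeforeRuns-zero a w u
onlyBeforeRuns-iterN a (suc j) w u = onlyBeforeRuns-N a j w _ (onlyBeforeRuns-iterN a j w u)

onlyBeforeRuns-noFactor⇒𝟘 : (a : Bool) (k : ℕ) (w v : Vec Bool n) → OnlyBeforeRuns a k w v →
  ¬ IsFactor (pow a k) (toList w) → v ≡ 𝟘
onlyBeforeRuns-noFactor⇒𝟘 a k []        []          _          _  = refl
onlyBeforeRuns-noFactor⇒𝟘 a k (w₁ ∷ ws) (true ∷ vs) (run , _) noRun
  with run tt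
... | s , eq = ⊥-elim (noRun (IsFactor-∷ w₁ (List.[] , s , eq)))
onlyBeforeRuns-noFactor⇒𝟘 a k (w₁ ∷ ws) (false ∷ vs) (_ , rest) noRun =
  cong (false ∷_) (onlyBeforeRuns-noFactor⇒𝟘 a k ws vs rest (noRun ∘ IsFactor-∷ w₁))

iterN-noFactor⇒𝟘 : (a : Bool) (k : ℕ) (w u : Vec Bool n) →
  ¬ IsFactor (pow a k) (toList w) → iter (N a w) k u ≡ 𝟘
iterN-noFactor⇒𝟘 a k w u =
  onlyBeforeRuns-noFactor⇒𝟘 a k w _ (onlyBeforeRuns-iterN a k w u)

corollary7p7 : (ℓ : ℕ) → 2 ≤ ℓ → (w : Vec Bool ℓ) → (a : Bool) → (k m : ℕ) → k ≡ 2 ^ m →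
    ¬ IsFactor (pow a k) (toList w) →
    (u : Vec Bool ℓ) → ∃[ n ] (1 ≤ n × n ≤ k × iter (S a w) n u ≡ u)
corollary7p7 ℓ _ w a k m refl noRun u = k , m^n>0 2 m , ≤-refl , S^k-fixes-u
  where
  open ≡-Reasoning
  S^k-fixes-u : iter (S a w) k u ≡ u
  S^k-fixes-u = begin
    iter (S a w) k u      ≡⟨ iter-id⊕-2^ (N-additive a w) (S≡id⊕N a w) m u ⟩
    u ⊕ iter (N a w) k u  ≡⟨ cong (u ⊕_) (iterN-noFactor⇒𝟘 a k w u noRun) ⟩
    u ⊕ 𝟘                 ≡⟨ ⊕-identityʳ u ⟩
    u                     ∎
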